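{- The variety of implicative modal lattices satisfying $a\le\Box\Diamond a$ and $\Diamond\Box a\le a$ for all $a$ (the algebraic semantics of $\mathbf\Lambda^\to_{\Box\Diamond}+\{\varphi\vdash\Box\Diamond\varphi,\ \Diamond\Box\varphi\vdash\varphi\}$) is canonical: it is closed under canonical extensions, where the canonical extension $(\alpha,\mathbf L^\sigma)$ of $\mathbf L$ is equipped with $\Diamond^\sigma$, $\Box^\pi$ and $\to^\pi$.
   Context: An implicative modal lattice is a bounded lattice $(L,\le,\wedge,\vee,0,1)$ with binary $\to$ and unary $\Box,\Diamond$ such that $(a\vee b)\to c=(a\to c)\wedge(b\to c)$, $a\to(b\wedge c)=(a\to b)\wedge(a\to c)$, $0\to a=1=a\to1$, $\Box(a\wedge b)=\Box a\wedge\Box b$, $\Box1=1$, $\Diamond(a\vee b)=\Diamond a\vee\Diamond b$, $\Diamond0=0$. A canonical extension of a bounded lattice $L$ is a complete lattice $C$ with a lattice embedding $\alpha:L\to C$ such that every element of $C$ is both a join of meets and a meet of joins of elements of $\alpha[L]$, and for any set $A$ of closed elements (meets of subsets of $\alpha[L]$) and set $B$ of open elements (joins of subsets of $\alpha[L]$), $\bigwedge A\le\bigvee B$ iff $\bigwedge A_1\le\bigvee B_1$ for some finite $A_1\subseteq A,B_1\subseteq B$. Identifying $L$ with $\alpha[L]$, for monotone unary $f$: $f^\sigma(k)=\bigwedge\{f(a):k\le a\in L\}$ for closed $k$, $f^\sigma(u)=\bigvee\{f^\sigma(k):k\le u,\ k$ closed$\}$; $f^\pi(o)=\bigvee\{f(a):L\ni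 a\le o\}$ for open $o$, $f^\pi(u)=\bigwedge\{f^\pi(o):u\le o,\ o$ open$\}$. For $\to$ (antitone in first, monotone in second argument), $\to^\pi$ is defined likewise regarding $\to$ as a monotone map $L^{\mathrm{op}}\times L\to L$, with closed and open elements swapping roles in the first coordinate. -}

module Defs where

open import Level using (Level; suc; _⊔_; Lift)
open import Data.Empty using () renaming (⊥ to Empty)
open import Data.Product using (Σ; ∃; ∃-syntax; _×_; _,_)
open import Data.Sum using (_⊎_)
open import Data.List using (List; foldr)
open import Data.List.Relation.Unary.All using (All)
open import Relation.Unary using (Pred)
open import Relation.Binary using (Rel; IsPartialOrder)
open import Relation.Binary.Lattice.Bundles using (BoundedLattice)
open import Algebra.Core using (Op₁; Op₂)
open import Algebra.Definitions using (Congruent₁; Congruent₂)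

record IMLAxioms {a ℓ : Level} {A : Set a} (_≈_ : Rel A ℓ)
                 (_∧_ _∨_ : Op₂ A) (bot top : A)
                 (_⇒_ : Op₂ A) (□ ◇ : Op₁ A) : Set (a ⊔ ℓ) where
  field
    ⇒-cong : Congruent₂ _≈_ _⇒_
    □-cong : Congruent₁ _≈_ □
    ◇-cong : Congruent₁ _≈_ ◇
    ∨-⇒    : ∀ x y z → ((x ∨ y) ⇒ z) ≈ ((x ⇒ z) ∧ (y ⇒ z))
    ⇒-∧    : ∀ x y z → (x ⇒ (y ∧ z)) ≈ ((x ⇒ y) ∧ (x ⇒ z))
    bot-⇒  : ∀ x → (bot ⇒ x) ≈ top
    ⇒-top  : ∀ x → (x ⇒ top) ≈ top
    □-∧    : ∀ x y → □ (x ∧ y) ≈ (□ x ∧ □ y)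
    □-top  : □ top ≈ top
    ◇-∨    : ∀ x y → ◇ (x ∨ y) ≈ (◇ x ∨ ◇ y)
    ◇-bot  : ◇ bot ≈ bot

record BoxDiaAxioms {a ℓ : Level} {A : Set a} (_≤_ : Rel A ℓ)
                    (□ ◇ : Op₁ A) : Set (a ⊔ ℓ) where
  field
    unit   : ∀ x → x ≤ □ (◇ x)
    counit : ∀ x → ◇ (□ x) ≤ x

record IML (ℓ : Level) : Set (suc ℓ) where
  field
    boundedLattice : BoundedLattice ℓ ℓ ℓ
  open BoundedLattice boundedLattice public
  field
    _⇒_    : Op₂ Carrier
    □      : Op₁ Carrier
    ◇      : Op₁ Carrier
    isIML  : IMLAxioms _≈_ _∧_ _∨_ ⊥ ⊤ _⇒_ □ ◇

InVariety : ∀ {ℓ} → IML ℓ → Set ℓ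
InVariety L = BoxDiaAxioms _≤_ □ ◇
  where open IML L

record CompleteLattice (ℓ : Level) : Set (suc (suc ℓ)) where
  infix 4 _≈_ _≤_
  field
    Carrier        : Set (suc ℓ)
    _≈_            : Rel Carrier (suc ℓ)
    _≤_            : Rel Carrier (suc ℓ)
    isPartialOrder : IsPartialOrder _≈_ _≤_
    ⋀              : Pred Carrier (suc ℓ) → Carrier
    ⋁              : Pred Carrier (suc ℓ) → Carrier
    ⋀-lower        : ∀ S x → S x → ⋀ S ≤ x
    ⋀-greatest     : ∀ S y → (∀ x → S x → y ≤ x) → y ≤ ⋀ S
    ⋁-upper        : ∀ S x → S x → x ≤ ⋁ S
    ⋁-least        : ∀ S y → (∀ x → S x → x ≤ y) → ⋁ S ≤ y

  infixr 7 _∧_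
  infixr 6 _∨_
  _∧_ : Op₂ Carrier
  x ∧ y = ⋀ (λ z → (z ≈ x) ⊎ (z ≈ y))

  _∨_ : Op₂ Carrier
  x ∨ y = ⋁ (λ z → (z ≈ x) ⊎ (z ≈ y))

  top : Carrier
  top = ⋀ (λ _ → Lift (suc ℓ) Empty)

  bot : Carrier
  bot = ⋁ (λ _ → Lift (suc ℓ) Empty)

  meetList : List Carrier → Carrier
  meetList = foldr _∧_ top

  joinList : List Carrier → Carrier
  joinList = foldr _∨_ bot

module _ {ℓ : Level} (L : IML ℓ) (C : CompleteLattice ℓ) where
  private
    module L = IML L
    module C = CompleteLattice C

  image : (L.Carrier → C.Carrier) → Pred L.Carrier ℓ → Pred C.Carrier (suc ℓ)
  image α S x = ∃[ a ] (S a × (x C.≈ α a))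

  IsClosed : (L.Carrier → C.Carrier) → C.Carrier → Set (suc ℓ)
  IsClosed α k = ∃[ S ] (k C.≈ C.⋀ (image α S))

  IsOpen : (L.Carrier → C.Carrier) → C.Carrier → Set (suc ℓ)
  IsOpen α o = ∃[ S ] (o C.≈ C.⋁ (image α S))

  record CanonicalExtension : Set (suc (suc ℓ)) where
    field
      α : L.Carrier → C.Carrier
      α-mono    : ∀ a b → a L.≤ b → α a C.≤ α b
      α-reflect : ∀ a b → α a C.≤ α b → a L.≤ b
      α-∧       : ∀ a b → α (a L.∧ b) C.≈ (α a C.∧ α b)
      α-∨       : ∀ a b → α (a L.∨ b) C.≈ (α a C.∨ α b)
      α-⊤       : α L.⊤ C.≈ C.top
      α-⊥       : α L.⊥ C.≈ C.bot
      dense-closed : ∀ u → ∃[ X ] ((∀ x → X x → IsClosed α x) × (u C.≈ C.⋁ X))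
      dense-open   : ∀ u → ∃[ Y ] ((∀ y → Y y → IsOpen α y) × (u C.≈ C.⋀ Y))
      compact : ∀ (A B : Pred C.Carrier (suc ℓ)) →
                (∀ x → A x → IsClosed α x) → (∀ y → B y → IsOpen α y) →
                ((C.⋀ A C.≤ C.⋁ B) →
                   ∃[ xs ] ∃[ ys ] (All A xs × All B ys ×
                                    (C.meetList xs C.≤ C.joinList ys)))
                × ((∃[ xs ] ∃[ ys ] (All A xs × All B ys ×
                                    (C.meetList xs C.≤ C.joinList ys)))
                   → C.⋀ A C.≤ C.⋁ B)

  module _ (E : CanonicalExtension) where
    open CanonicalExtension E

    σ-closed : Op₁ L.Carrier → C.Carrier → C.Carrier
    σ-closed f k = C.⋀ (λ x → ∃[ a ] ((k C.≤ α a) × (x C.≈ α (f a))))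

    σ-ext : Op₁ L.Carrier → C.Carrier → C.Carrier
    σ-ext f u = C.⋁ (λ x → ∃[ k ] (IsClosed α k × (k C.≤ u) × (x C.≈ σ-closed f k)))

    π-open : Op₁ L.Carrier → C.Carrier → C.Carrier
    π-open f o = C.⋁ (λ x → ∃[ a ] ((α a C.≤ o) × (x C.≈ α (f a))))

    π-ext : Op₁ L.Carrier → C.Carrier → C.Carrier
    π-ext f u = C.⋀ (λ x → ∃[ o ] (IsOpen α o × (u C.≤ o) × (x C.≈ π-open f o)))

    -- π-extension of a binary map antitone in the first and monotone in the
    -- second argument, viewed as a monotone map L^op × L → L.  Open elements
    -- of C^op × C are the pairs (closed, open).
    π-open₂ : Op₂ L.Carrier → C.Carrier → C.Carrier → C.Carrier
    π-open₂ g k o = C.⋁ (λ x → ∃[ a ] ∃[ b ] ((k C.≤ α a) × (α b C.≤ o) × (x C.≈ α (g a b))))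

    π-ext₂ : Op₂ L.Carrier → C.Carrier → C.Carrier → C.Carrier
    π-ext₂ g u v = C.⋀ (λ x → ∃[ k ] ∃[ o ] (IsClosed α k × IsOpen α o ×
                                (k C.≤ u) × (v C.≤ o) × (x C.≈ π-open₂ g k o)))

    ⇒π : Op₂ C.Carrier
    ⇒π = π-ext₂ L._⇒_

    □π : Op₁ C.Carrier
    □π = π-ext L.□

    ◇σ : Op₁ C.Carrier
    ◇σ = σ-ext L.◇

{-# OPTIONS --safe #-}
-- Compactness and density turn every inequality in the canonical extension into one against
-- a closed element c or an open element o, and that into a statement about L: ◇^σ u ≤ o iff
-- u is below the join of the ideal {a ∣ ◇ a ≤ o}; c ≤ □^π u iff the meet of the filter
-- {a ∣ c ≤ □ a} is below u; and c ≤ u ⇒^π v iff u is below the join of the ideal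
-- {a ∣ ∃ b ≤ o. c ≤ a ⇒ b} for every open o ≥ v, iff the meet of the filter
-- {b ∣ ∃ a ≥ k. c ≤ a ⇒ b} is below v for every closed k ≤ u. Being below the join of an
-- ideal is stable under binary joins (dually for filters), which gives the join and meet
-- laws. For a ≤ □◇a: each a with ◇ a ≤ o has a ≤ □◇a ≤ □^π o; for ◇□a ≤ a: each a with
-- k ≤ □ a has ◇^σ k ≤ ◇□a ≤ a.
module Submission where

open import Defs
open import Level using (Level; lift) renaming (suc to lsuc)
open import Algebra.Core using (Op₁; Op₂)
open import Algebra.Definitions using (Congruent₁)
open import Data.List.Relation.Unary.All using (All; []; _∷_)
open import Data.Product using (_×_; ∃; ∃-syntax; _,_; proj₁; proj₂)
open import Data.Sum using (inj₁; inj₂)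
open import Function.Bundles using (_⇔_; mk⇔; module Equivalence)
open import Relation.Binary.Core using (_Preserves_⟶_)
open import Relation.Binary.PropositionalEquality as ≡ using (_≡_)
open import Relation.Binary.Lattice.Bundles using (Lattice; BoundedLattice)
open import Relation.Binary.Structures using (IsPartialOrder)
open import Relation.Unary using (Pred)
import Function.Properties.Equivalence as ⇔
import Relation.Binary.Lattice.Properties.JoinSemilattice as JoinSemilatticeProperties
import Relation.Binary.Properties.Poset as PosetProperties
import Relation.Binary.Reasoning.PartialOrder as PartialOrderReasoning

open Equivalence using (to; from)

module LatticeProperties {c ℓ₁ ℓ₂} (L : Lattice c ℓ₁ ℓ₂) where
  open Lattice L
  open JoinSemilatticeProperties joinSemilattice using (x≤y⇒x∨y≈y)
  open PartialOrderReasoning poset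

  x≤y⇒x∧y≈x : ∀ {x y} → x ≤ y → x ∧ y ≈ x
  x≤y⇒x∧y≈x x≤y = antisym (x∧y≤x _ _) (∧-greatest refl x≤y)

  ∨-preserving⇒monotone : ∀ {f} → Congruent₁ _≈_ f → (∀ x y → f (x ∨ y) ≈ f x ∨ f y) →
                          f Preserves _≤_ ⟶ _≤_
  ∨-preserving⇒monotone {f} f-cong f-∨ {x} {y} x≤y = begin
    f x        ≤⟨ x≤x∨y _ _ ⟩
    f x ∨ f y  ≈⟨ Eq.sym (f-∨ x y) ⟩
    f (x ∨ y)  ≈⟨ f-cong (x≤y⇒x∨y≈y x≤y) ⟩
    f y        ∎

  ∧-preserving⇒monotone : ∀ {f} → Congruent₁ _≈_ f → (∀ x y → f (x ∧ y) ≈ f x ∧ f y) →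
                          f Preserves _≤_ ⟶ _≤_
  ∧-preserving⇒monotone {f} f-cong f-∧ {x} {y} x≤y = begin
    f x        ≈⟨ f-cong (Eq.sym (x≤y⇒x∧y≈x x≤y)) ⟩
    f (x ∧ y)  ≈⟨ f-∧ x y ⟩
    f x ∧ f y  ≤⟨ x∧y≤y _ _ ⟩
    f y        ∎

  ∨-to-∧⇒antitone : ∀ {f} → Congruent₁ _≈_ f → (∀ x y → f (x ∨ y) ≈ f x ∧ f y) →
                    ∀ {x y} → x ≤ y → f y ≤ f x
  ∨-to-∧⇒antitone {f} f-cong f-∨ {x} {y} x≤y = begin
    f y        ≈⟨ f-cong (Eq.sym (x≤y⇒x∨y≈y x≤y)) ⟩
    f (x ∨ y)  ≈⟨ f-∨ x y ⟩
    f x ∧ f y  ≤⟨ x∧y≤x _ _ ⟩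
    f x        ∎

module IMLProperties {ℓ : Level} (L : IML ℓ) where
  open IML L
  open IMLAxioms isIML
  open LatticeProperties lattice

  ⇒-mono : ∀ {a a′ b b′} → a′ ≤ a → b ≤ b′ → (a ⇒ b) ≤ (a′ ⇒ b′)
  ⇒-mono {a′ = a′} {b = b} a′≤a b≤b′ = trans
    (∨-to-∧⇒antitone (λ e → ⇒-cong e Eq.refl) (λ x y → ∨-⇒ x y b) a′≤a)
    (∧-preserving⇒monotone (⇒-cong Eq.refl) (⇒-∧ a′) b≤b′)

module CompleteLatticeProperties {ℓ : Level} (C : CompleteLattice ℓ) where
  open CompleteLattice C
  open IsPartialOrder isPartialOrder using (module Eq; trans; reflexive)

  boundedLattice : BoundedLattice (lsuc ℓ) (lsuc ℓ) (lsuc ℓ)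
  boundedLattice = record
    { Carrier = Carrier ; _≈_ = _≈_ ; _≤_ = _≤_ ; _∨_ = _∨_ ; _∧_ = _∧_ ; ⊤ = top ; ⊥ = bot
    ; isBoundedLattice = record
      { isLattice = record
        { isPartialOrder = isPartialOrder
        ; supremum = λ x y → ⋁-upper _ x (inj₁ Eq.refl) , ⋁-upper _ y (inj₂ Eq.refl) ,
            λ z x≤z y≤z → ⋁-least _ z λ { _ (inj₁ w≈x) → trans (reflexive w≈x) x≤z
                                        ; _ (inj₂ w≈y) → trans (reflexive w≈y) y≤z }
        ; infimum = λ x y → ⋀-lower _ x (inj₁ Eq.refl) , ⋀-lower _ y (inj₂ Eq.refl) ,
            λ z z≤x z≤y → ⋀-greatest _ z λ { _ (inj₁ w≈x) → trans z≤x (reflexive (Eq.sym w≈x))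
                                           ; _ (inj₂ w≈y) → trans z≤y (reflexive (Eq.sym w≈y)) }
        }
      ; maximum = λ x → ⋀-greatest _ x λ { _ (lift ()) }
      ; minimum = λ x → ⋁-least _ x λ { _ (lift ()) }
      }
    }

  open BoundedLattice boundedLattice using (∨-least; ∧-greatest; maximum; minimum)

  Subset : Set (lsuc (lsuc ℓ))
  Subset = Pred Carrier (lsuc ℓ)

  Directed : Subset → Set (lsuc ℓ)
  Directed S = ∃ S × (∀ {x y} → S x → S y → ∃[ z ] (S z × x ≤ z × y ≤ z))

  Filtered : Subset → Set (lsuc ℓ)
  Filtered S = ∃ S × (∀ {x y} → S x → S y → ∃[ z ] (S z × z ≤ x × z ≤ y))

  directed⇒joinList-bounded : ∀ {S} → Directed S → ∀ {ys} → All S ys →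
                              ∃[ z ] (S z × joinList ys ≤ z)
  directed⇒joinList-bounded ((z , Sz) , _) [] = z , Sz , minimum z
  directed⇒joinList-bounded S-directed@(_ , bound) (Sy ∷ Sys) =
    let z , Sz , ys≤z = directed⇒joinList-bounded S-directed Sys
        w , Sw , y≤w , z≤w = bound Sy Sz
    in w , Sw , ∨-least y≤w (trans ys≤z z≤w)

  filtered⇒meetList-bounded : ∀ {S} → Filtered S → ∀ {xs} → All S xs →
                              ∃[ z ] (S z × z ≤ meetList xs)
  filtered⇒meetList-bounded ((z , Sz) , _) [] = z , Sz , maximum z
  filtered⇒meetList-bounded S-filtered@(_ , bound) (Sx ∷ Sxs) =
    let z , Sz , z≤xs = filtered⇒meetList-bounded S-filtered Sxs
        w , Sw , w≤x , w≤z = bound Sx Sz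
    in w , Sw , ∧-greatest w≤x (trans w≤z z≤xs)

module CanonicalExtensionProperties {ℓ : Level} (L : IML ℓ) (C : CompleteLattice ℓ)
                                    (E : CanonicalExtension L C) where
  private
    module L where
      open IML L public
      open IMLAxioms isIML public
      open LatticeProperties lattice public
      open IMLProperties L public
    module C where
      open CompleteLattice C public
      open CompleteLatticeProperties C public
      open BoundedLattice boundedLattice public
        using (x≤x∨y; y≤x∨y; ∨-least; x∧y≤x; x∧y≤y; ∧-greatest; maximum; minimum;
               refl; trans; reflexive; antisym; module Eq; poset)
      open PosetProperties poset public using (mono⇒cong; ≥-reflexive)

  open CanonicalExtension E
  open C using (_≈_; _≤_; _∧_; _∨_; top; bot; ⋀; ⋁; Subset; Directed; Filtered)

  Closed : C.Carrier → Set (lsuc ℓ)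
  Closed = IsClosed L C α

  Open : C.Carrier → Set (lsuc ℓ)
  Open = IsOpen L C α

  InImage : Subset → Set (lsuc ℓ)
  InImage S = ∀ {x} → S x → ∃[ a ] (x ≈ α a)

  α[_] : Pred L.Carrier (lsuc ℓ) → Subset
  α[ P ] x = ∃[ a ] (P a × x ≈ α a)

  JoinClosed : Pred L.Carrier (lsuc ℓ) → Set (lsuc ℓ)
  JoinClosed P = P L.⊥ × (∀ {a b} → P a → P b → P (a L.∨ b))

  MeetClosed : Pred L.Carrier (lsuc ℓ) → Set (lsuc ℓ)
  MeetClosed P = P L.⊤ × (∀ {a b} → P a → P b → P (a L.∧ b))

  α-cong : ∀ {a b} → a L.≈ b → α a ≈ α b
  α-cong a≈b = C.antisym (α-mono _ _ (L.reflexive a≈b)) (α-mono _ _ (L.reflexive (L.Eq.sym a≈b)))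

  ≤α-of-≈⊤ : ∀ {a x} → a L.≈ L.⊤ → x ≤ α a
  ≤α-of-≈⊤ {x = x} a≈⊤ = C.trans (C.maximum x) (C.≥-reflexive (C.Eq.trans (α-cong a≈⊤) α-⊤))

  α-≤-of-≈⊥ : ∀ {a x} → a L.≈ L.⊥ → α a ≤ x
  α-≤-of-≈⊥ {x = x} a≈⊥ = C.trans (C.reflexive (C.Eq.trans (α-cong a≈⊥) α-⊥)) (C.minimum x)

  ≤α-∧ : ∀ {a b x} → x ≤ α a → x ≤ α b → x ≤ α (a L.∧ b)
  ≤α-∧ x≤αa x≤αb = C.trans (C.∧-greatest x≤αa x≤αb) (C.≥-reflexive (α-∧ _ _))

  α-∨-≤ : ∀ {a b x} → α a ≤ x → α b ≤ x → α (a L.∨ b) ≤ x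
  α-∨-≤ αa≤x αb≤x = C.trans (C.reflexive (α-∨ _ _)) (C.∨-least αa≤x αb≤x)

  closed-≈α : ∀ {x a} → x ≈ α a → Closed x
  closed-≈α {x} {a} x≈αa = (_≡ a) , C.antisym
    (C.⋀-greatest _ x λ { _ (_ , ≡.refl , y≈αa) → C.reflexive (C.Eq.trans x≈αa (C.Eq.sym y≈αa)) })
    (C.⋀-lower _ x (a , ≡.refl , x≈αa))

  open-≈α : ∀ {x a} → x ≈ α a → Open x
  open-≈α {x} {a} x≈αa = (_≡ a) , C.antisym
    (C.⋁-upper _ x (a , ≡.refl , x≈αa))
    (C.⋁-least _ x λ { _ (_ , ≡.refl , y≈αa) → C.reflexive (C.Eq.trans y≈αa (C.Eq.sym x≈αa)) })

  α[]-inImage : ∀ {P} → InImage α[ P ]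
  α[]-inImage (a , _ , x≈αa) = a , x≈αa

  joinClosed⇒directed : ∀ {P} → JoinClosed P → Directed α[ P ]
  joinClosed⇒directed (P⊥ , P∨) = (α L.⊥ , L.⊥ , P⊥ , C.Eq.refl) ,
    λ { (a , Pa , x≈αa) (b , Pb , y≈αb) → α (a L.∨ b) , (a L.∨ b , P∨ Pa Pb , C.Eq.refl) ,
          C.trans (C.reflexive x≈αa) (α-mono _ _ (L.x≤x∨y a b)) ,
          C.trans (C.reflexive y≈αb) (α-mono _ _ (L.y≤x∨y a b)) }

  meetClosed⇒filtered : ∀ {P} → MeetClosed P → Filtered α[ P ]
  meetClosed⇒filtered (P⊤ , P∧) = (α L.⊤ , L.⊤ , P⊤ , C.Eq.refl) ,
    λ { (a , Pa , x≈αa) (b , Pb , y≈αb) → α (a L.∧ b) , (a L.∧ b , P∧ Pa Pb , C.Eq.refl) ,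
          C.trans (α-mono _ _ (L.x∧y≤x a b)) (C.≥-reflexive x≈αa) ,
          C.trans (α-mono _ _ (L.x∧y≤y a b)) (C.≥-reflexive y≈αb) }

  ↑ : C.Carrier → Pred L.Carrier (lsuc ℓ)
  ↑ k a = k ≤ α a

  ↓ : C.Carrier → Pred L.Carrier (lsuc ℓ)
  ↓ o a = α a ≤ o

  ↑-meetClosed : ∀ {k} → MeetClosed (↑ k)
  ↑-meetClosed = ≤α-of-≈⊤ L.Eq.refl , ≤α-∧

  ↓-joinClosed : ∀ {o} → JoinClosed (↓ o)
  ↓-joinClosed = α-≤-of-≈⊥ L.Eq.refl , α-∨-≤

  closed⇒⋀↑≤ : ∀ {k} → Closed k → ⋀ α[ ↑ k ] ≤ k
  closed⇒⋀↑≤ {k} (S , k≈⋀S) = C.trans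
    (C.⋀-greatest _ _ λ { y Sy@(a , _ , y≈αa) →
       let k≤y = C.trans (C.reflexive k≈⋀S) (C.⋀-lower _ y Sy)
       in C.⋀-lower _ y (a , C.trans k≤y (C.reflexive y≈αa) , y≈αa) })
    (C.≥-reflexive k≈⋀S)

  open⇒≤⋁↓ : ∀ {o} → Open o → o ≤ ⋁ α[ ↓ o ]
  open⇒≤⋁↓ {o} (S , o≈⋁S) = C.trans (C.reflexive o≈⋁S)
    (C.⋁-least _ _ λ { y Sy@(a , _ , y≈αa) →
       let y≤o = C.trans (C.⋁-upper _ y Sy) (C.≥-reflexive o≈⋁S)
       in C.⋁-upper _ y (a , C.trans (C.≥-reflexive y≈αa) y≤o , y≈αa) })

  compact-filtered-directed : ∀ {S T} → InImage S → InImage T → Filtered S → Directed T →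
                              ⋀ S ≤ ⋁ T → ∃[ x ] ∃[ y ] (S x × T y × x ≤ y)
  compact-filtered-directed S⊆α T⊆α S-filtered T-directed ⋀S≤⋁T =
    let xs , ys , Sxs , Tys , xs≤ys = proj₁ (compact _ _ (λ _ Sx → closed-≈α (proj₂ (S⊆α Sx)))
                                                         (λ _ Ty → open-≈α (proj₂ (T⊆α Ty)))) ⋀S≤⋁T
        x , Sx , x≤xs = C.filtered⇒meetList-bounded S-filtered Sxs
        y , Ty , ys≤y = C.directed⇒joinList-bounded T-directed Tys
    in x , y , Sx , Ty , C.trans x≤xs (C.trans xs≤ys ys≤y)

  closed≤⋁directed : ∀ {k T} → Closed k → InImage T → Directed T → k ≤ ⋁ T → ∃[ y ] (T y × k ≤ y)
  closed≤⋁directed k-closed T⊆α T-directed k≤⋁T =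
    let x , y , (a , k≤αa , x≈αa) , Ty , x≤y =
          compact-filtered-directed α[]-inImage T⊆α (meetClosed⇒filtered ↑-meetClosed) T-directed
                                    (C.trans (closed⇒⋀↑≤ k-closed) k≤⋁T)
    in y , Ty , C.trans k≤αa (C.trans (C.≥-reflexive x≈αa) x≤y)

  ⋀filtered≤open : ∀ {o S} → Open o → InImage S → Filtered S → ⋀ S ≤ o → ∃[ x ] (S x × x ≤ o)
  ⋀filtered≤open o-open S⊆α S-filtered ⋀S≤o =
    let x , y , Sx , (a , αa≤o , y≈αa) , x≤y =
          compact-filtered-directed S⊆α α[]-inImage S-filtered (joinClosed⇒directed ↓-joinClosed)
                                    (C.trans ⋀S≤o (open⇒≤⋁↓ o-open))
    in x , Sx , C.trans x≤y (C.trans (C.reflexive y≈αa) αa≤o)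

  ≤-from-closed : ∀ {u v} → (∀ {k} → Closed k → k ≤ u → k ≤ v) → u ≤ v
  ≤-from-closed {u} {v} below =
    let X , X-closed , u≈⋁X = dense-closed u
    in C.trans (C.reflexive u≈⋁X) (C.⋁-least X v λ k Xk →
         below (X-closed k Xk) (C.trans (C.⋁-upper X k Xk) (C.≥-reflexive u≈⋁X)))

  ≤-from-open : ∀ {u v} → (∀ {o} → Open o → v ≤ o → u ≤ o) → u ≤ v
  ≤-from-open {u} {v} above =
    let Y , Y-open , v≈⋀Y = dense-open v
    in C.trans (C.⋀-greatest Y u λ o Yo →
         above (Y-open o Yo) (C.trans (C.reflexive v≈⋀Y) (C.⋀-lower Y o Yo))) (C.≥-reflexive v≈⋀Y)

  ≤⋁α⇔ : ∀ {P u} → JoinClosed P →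
         u ≤ ⋁ α[ P ] ⇔ (∀ {k} → Closed k → k ≤ u → ∃[ a ] (P a × k ≤ α a))
  ≤⋁α⇔ P-joinClosed = mk⇔
    (λ u≤⋁ {k} k-closed k≤u →
       let y , (a , Pa , y≈αa) , k≤y = closed≤⋁directed k-closed α[]-inImage
                                         (joinClosed⇒directed P-joinClosed) (C.trans k≤u u≤⋁)
       in a , Pa , C.trans k≤y (C.reflexive y≈αa))
    (λ covered → ≤-from-closed λ k-closed k≤u →
       let a , Pa , k≤αa = covered k-closed k≤u
       in C.trans k≤αa (C.⋁-upper _ _ (a , Pa , C.Eq.refl)))

  ⋀α≤⇔ : ∀ {P u} → MeetClosed P →
         ⋀ α[ P ] ≤ u ⇔ (∀ {o} → Open o → u ≤ o → ∃[ a ] (P a × α a ≤ o))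
  ⋀α≤⇔ P-meetClosed = mk⇔
    (λ ⋀≤u {o} o-open u≤o →
       let x , (a , Pa , x≈αa) , x≤o = ⋀filtered≤open o-open α[]-inImage
                                         (meetClosed⇒filtered P-meetClosed) (C.trans ⋀≤u u≤o)
       in a , Pa , C.trans (C.≥-reflexive x≈αa) x≤o)
    (λ covered → ≤-from-open λ o-open u≤o →
       let a , Pa , αa≤o = covered o-open u≤o
       in C.trans (C.⋀-lower _ _ (a , Pa , C.Eq.refl)) αa≤o)

  _^σ : Op₁ L.Carrier → Op₁ C.Carrier
  f ^σ = σ-ext L C E f

  _^π : Op₁ L.Carrier → Op₁ C.Carrier
  f ^π = π-ext L C E f

  -- ⋀ (f [↑ k ]), ⋁ (f [↓ o ]) and ⋁ ⇒[ k , o ] unfold to σ-closed f k, π-open f o and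
  -- π-open₂ _⇒_ k o.
  _[↑_] : Op₁ L.Carrier → C.Carrier → Subset
  (f [↑ k ]) x = ∃[ a ] (k ≤ α a × x ≈ α (f a))

  _[↓_] : Op₁ L.Carrier → C.Carrier → Subset
  (f [↓ o ]) x = ∃[ a ] (α a ≤ o × x ≈ α (f a))

  [↑]-inImage : ∀ {f k} → InImage (f [↑ k ])
  [↑]-inImage (_ , _ , x≈αfa) = _ , x≈αfa

  [↓]-inImage : ∀ {f o} → InImage (f [↓ o ])
  [↓]-inImage (_ , _ , x≈αfa) = _ , x≈αfa

  ⋀[↑]≤ : ∀ f {k a} → k ≤ α a → ⋀ (f [↑ k ]) ≤ α (f a)
  ⋀[↑]≤ f k≤αa = C.⋀-lower _ _ (_ , k≤αa , C.Eq.refl)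

  ≤⋁[↓] : ∀ f {o a} → α a ≤ o → α (f a) ≤ ⋁ (f [↓ o ])
  ≤⋁[↓] f αa≤o = C.⋁-upper _ _ (_ , αa≤o , C.Eq.refl)

  ^σ-mono : ∀ f → (f ^σ) Preserves _≤_ ⟶ _≤_
  ^σ-mono f u≤v = C.⋁-least _ _ λ { x (k , k-closed , k≤u , x≈) →
    C.⋁-upper _ x (k , k-closed , C.trans k≤u u≤v , x≈) }

  ^π-mono : ∀ f → (f ^π) Preserves _≤_ ⟶ _≤_
  ^π-mono f u≤v = C.⋀-greatest _ _ λ { x (o , o-open , v≤o , x≈) →
    C.⋀-lower _ x (o , o-open , C.trans u≤v v≤o , x≈) }

  ^σ-cong : ∀ f → Congruent₁ _≈_ (f ^σ)
  ^σ-cong f = C.mono⇒cong (^σ-mono f)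

  ^π-cong : ∀ f → Congruent₁ _≈_ (f ^π)
  ^π-cong f = C.mono⇒cong (^π-mono f)

  module _ {f : Op₁ L.Carrier} (f-mono : f Preserves L._≤_ ⟶ L._≤_) where

    [↑]-filtered : ∀ {k} → Filtered (f [↑ k ])
    [↑]-filtered = (α (f L.⊤) , L.⊤ , ≤α-of-≈⊤ L.Eq.refl , C.Eq.refl) ,
      λ { (a , k≤αa , x≈) (b , k≤αb , y≈) →
            α (f (a L.∧ b)) , (a L.∧ b , ≤α-∧ k≤αa k≤αb , C.Eq.refl) ,
            C.trans (α-mono _ _ (f-mono (L.x∧y≤x a b))) (C.≥-reflexive x≈) ,
            C.trans (α-mono _ _ (f-mono (L.x∧y≤y a b))) (C.≥-reflexive y≈) }

    [↓]-directed : ∀ {o} → Directed (f [↓ o ])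
    [↓]-directed = (α (f L.⊥) , L.⊥ , α-≤-of-≈⊥ L.Eq.refl , C.Eq.refl) ,
      λ { (a , αa≤o , x≈) (b , αb≤o , y≈) →
            α (f (a L.∨ b)) , (a L.∨ b , α-∨-≤ αa≤o αb≤o , C.Eq.refl) ,
            C.trans (C.reflexive x≈) (α-mono _ _ (f-mono (L.x≤x∨y a b))) ,
            C.trans (C.reflexive y≈) (α-mono _ _ (f-mono (L.y≤x∨y a b))) }

    ^σ≤⇔ : ∀ {u o} → Open o →
           (f ^σ) u ≤ o ⇔ (∀ {k} → Closed k → k ≤ u → ∃[ a ] (α (f a) ≤ o × k ≤ α a))
    ^σ≤⇔ o-open = mk⇔
      (λ fu≤o {k} k-closed k≤u →
         let x , (a , k≤αa , x≈αfa) , x≤o =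
               ⋀filtered≤open o-open [↑]-inImage [↑]-filtered
                              (C.trans (C.⋁-upper _ _ (k , k-closed , k≤u , C.Eq.refl)) fu≤o)
         in a , C.trans (C.≥-reflexive x≈αfa) x≤o , k≤αa)
      (λ witness → C.⋁-least _ _ λ { x (k , k-closed , k≤u , x≈) →
         let a , αfa≤o , k≤αa = witness k-closed k≤u
         in C.trans (C.reflexive x≈) (C.trans (⋀[↑]≤ f k≤αa) αfa≤o) })

    ≤^π⇔ : ∀ {c u} → Closed c →
           c ≤ (f ^π) u ⇔ (∀ {o} → Open o → u ≤ o → ∃[ a ] (c ≤ α (f a) × α a ≤ o))
    ≤^π⇔ c-closed = mk⇔
      (λ c≤fu {o} o-open u≤o →
         let y , (a , αa≤o , y≈αfa) , c≤y =
               closed≤⋁directed c-closed [↓]-inImage [↓]-directed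
                                (C.trans c≤fu (C.⋀-lower _ _ (o , o-open , u≤o , C.Eq.refl)))
         in a , C.trans c≤y (C.reflexive y≈αfa) , αa≤o)
      (λ witness → C.⋀-greatest _ _ λ { x (o , o-open , u≤o , x≈) →
         let a , c≤αfa , αa≤o = witness o-open u≤o
         in C.trans c≤αfa (C.trans (≤⋁[↓] f αa≤o) (C.≥-reflexive x≈)) })

  module JoinPreserving {f : Op₁ L.Carrier} (f-cong : Congruent₁ L._≈_ f)
                        (f-∨ : ∀ a b → f (a L.∨ b) L.≈ f a L.∨ f b) (f-⊥ : f L.⊥ L.≈ L.⊥) where

    f⁻¹↓ : C.Carrier → Pred L.Carrier (lsuc ℓ)
    f⁻¹↓ o a = α (f a) ≤ o

    f⁻¹↓-joinClosed : ∀ {o} → JoinClosed (f⁻¹↓ o)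
    f⁻¹↓-joinClosed = α-≤-of-≈⊥ f-⊥ ,
      λ αfa≤o αfb≤o → C.trans (C.reflexive (α-cong (f-∨ _ _))) (α-∨-≤ αfa≤o αfb≤o)

    ^σ≤⇔≤⋁ : ∀ {u o} → Open o → (f ^σ) u ≤ o ⇔ u ≤ ⋁ α[ f⁻¹↓ o ]
    ^σ≤⇔≤⋁ o-open = ⇔.trans (^σ≤⇔ (L.∨-preserving⇒monotone f-cong f-∨) o-open)
                            (⇔.sym (≤⋁α⇔ f⁻¹↓-joinClosed))

    ^σ-∨ : ∀ x y → (f ^σ) (x ∨ y) ≈ (f ^σ) x ∨ (f ^σ) y
    ^σ-∨ x y = C.antisym
      (≤-from-open λ o-open fx∨fy≤o → from (^σ≤⇔≤⋁ o-open) (C.∨-least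
        (to (^σ≤⇔≤⋁ o-open) (C.trans (C.x≤x∨y _ _) fx∨fy≤o))
        (to (^σ≤⇔≤⋁ o-open) (C.trans (C.y≤x∨y _ _) fx∨fy≤o))))
      (C.∨-least (^σ-mono f (C.x≤x∨y x y)) (^σ-mono f (C.y≤x∨y x y)))

    ^σ-bot : (f ^σ) bot ≈ bot
    ^σ-bot = C.antisym
      (C.trans (from (^σ≤⇔≤⋁ (open-≈α C.Eq.refl)) (C.minimum _)) (C.reflexive α-⊥))
      (C.minimum _)

  module MeetPreserving {f : Op₁ L.Carrier} (f-cong : Congruent₁ L._≈_ f)
                        (f-∧ : ∀ a b → f (a L.∧ b) L.≈ f a L.∧ f b) (f-⊤ : f L.⊤ L.≈ L.⊤) where

    f⁻¹↑ : C.Carrier → Pred L.Carrier (lsuc ℓ)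
    f⁻¹↑ c a = c ≤ α (f a)

    f⁻¹↑-meetClosed : ∀ {c} → MeetClosed (f⁻¹↑ c)
    f⁻¹↑-meetClosed = ≤α-of-≈⊤ f-⊤ ,
      λ c≤αfa c≤αfb → C.trans (≤α-∧ c≤αfa c≤αfb) (C.reflexive (α-cong (L.Eq.sym (f-∧ _ _))))

    ≤^π⇔⋀≤ : ∀ {c u} → Closed c → c ≤ (f ^π) u ⇔ ⋀ α[ f⁻¹↑ c ] ≤ u
    ≤^π⇔⋀≤ c-closed = ⇔.trans (≤^π⇔ (L.∧-preserving⇒monotone f-cong f-∧) c-closed)
                              (⇔.sym (⋀α≤⇔ f⁻¹↑-meetClosed))

    ^π-∧ : ∀ x y → (f ^π) (x ∧ y) ≈ (f ^π) x ∧ (f ^π) y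
    ^π-∧ x y = C.antisym
      (C.∧-greatest (^π-mono f (C.x∧y≤x x y)) (^π-mono f (C.x∧y≤y x y)))
      (≤-from-closed λ c-closed c≤fx∧fy → from (≤^π⇔⋀≤ c-closed) (C.∧-greatest
        (to (≤^π⇔⋀≤ c-closed) (C.trans c≤fx∧fy (C.x∧y≤x _ _)))
        (to (≤^π⇔⋀≤ c-closed) (C.trans c≤fx∧fy (C.x∧y≤y _ _)))))

    ^π-top : (f ^π) top ≈ top
    ^π-top = C.antisym
      (C.maximum _)
      (C.trans (C.≥-reflexive α-⊤) (from (≤^π⇔⋀≤ (closed-≈α C.Eq.refl)) (C.maximum _)))

  _⇒^π_ : Op₂ C.Carrier
  _⇒^π_ = π-ext₂ L C E L._⇒_

  ⇒^π-mono : ∀ {u u′ v v′} → u′ ≤ u → v ≤ v′ → u ⇒^π v ≤ u′ ⇒^π v′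
  ⇒^π-mono u′≤u v≤v′ = C.⋀-greatest _ _ λ { x (k , o , k-closed , o-open , k≤u′ , v′≤o , x≈) →
    C.⋀-lower _ x (k , o , k-closed , o-open , C.trans k≤u′ u′≤u , C.trans v≤v′ v′≤o , x≈) }

  ⇒^π-cong : ∀ {u u′ v v′} → u ≈ u′ → v ≈ v′ → u ⇒^π v ≈ u′ ⇒^π v′
  ⇒^π-cong u≈u′ v≈v′ = C.antisym
    (⇒^π-mono (C.≥-reflexive u≈u′) (C.reflexive v≈v′))
    (⇒^π-mono (C.reflexive u≈u′) (C.≥-reflexive v≈v′))

  ⇒[_,_] : C.Carrier → C.Carrier → Subset
  ⇒[ k , o ] x = ∃[ a ] ∃[ b ] (k ≤ α a × α b ≤ o × x ≈ α (a L.⇒ b))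

  ⇒[]-inImage : ∀ {k o} → InImage ⇒[ k , o ]
  ⇒[]-inImage (_ , _ , _ , _ , x≈) = _ , x≈

  ⇒[]-directed : ∀ {k o} → Directed ⇒[ k , o ]
  ⇒[]-directed =
    (α (L.⊤ L.⇒ L.⊥) , L.⊤ , L.⊥ , ≤α-of-≈⊤ L.Eq.refl , α-≤-of-≈⊥ L.Eq.refl , C.Eq.refl) ,
    λ { (a , b , k≤αa , αb≤o , x≈) (a′ , b′ , k≤αa′ , αb′≤o , y≈) →
          α ((a L.∧ a′) L.⇒ (b L.∨ b′)) ,
          (a L.∧ a′ , b L.∨ b′ , ≤α-∧ k≤αa k≤αa′ , α-∨-≤ αb≤o αb′≤o , C.Eq.refl) ,
          C.trans (C.reflexive x≈) (α-mono _ _ (L.⇒-mono (L.x∧y≤x a a′) (L.x≤x∨y b b′))) ,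
          C.trans (C.reflexive y≈) (α-mono _ _ (L.⇒-mono (L.x∧y≤y a a′) (L.y≤x∨y b b′))) }

  ≤⇒^π⇔ : ∀ {c u v} → Closed c →
          c ≤ u ⇒^π v ⇔ (∀ {k o} → Closed k → Open o → k ≤ u → v ≤ o →
                           ∃[ a ] ∃[ b ] (k ≤ α a × α b ≤ o × c ≤ α (a L.⇒ b)))
  ≤⇒^π⇔ c-closed = mk⇔
    (λ c≤u⇒v {k} {o} k-closed o-open k≤u v≤o →
       let y , (a , b , k≤αa , αb≤o , y≈) , c≤y =
             closed≤⋁directed c-closed ⇒[]-inImage ⇒[]-directed
               (C.trans c≤u⇒v (C.⋀-lower _ _ (k , o , k-closed , o-open , k≤u , v≤o , C.Eq.refl)))
       in a , b , k≤αa , αb≤o , C.trans c≤y (C.reflexive y≈))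
    (λ witness → C.⋀-greatest _ _ λ { x (k , o , k-closed , o-open , k≤u , v≤o , x≈) →
       let a , b , k≤αa , αb≤o , c≤αa⇒b = witness k-closed o-open k≤u v≤o
       in C.trans c≤αa⇒b (C.trans (C.⋁-upper _ _ (a , b , k≤αa , αb≤o , C.Eq.refl))
                                  (C.≥-reflexive x≈)) })

  antecedents : C.Carrier → C.Carrier → Pred L.Carrier (lsuc ℓ)
  antecedents c o a = ∃[ b ] (α b ≤ o × c ≤ α (a L.⇒ b))

  consequents : C.Carrier → C.Carrier → Pred L.Carrier (lsuc ℓ)
  consequents c k b = ∃[ a ] (k ≤ α a × c ≤ α (a L.⇒ b))

  antecedents-joinClosed : ∀ {c o} → JoinClosed (antecedents c o)
  antecedents-joinClosed = (L.⊥ , α-≤-of-≈⊥ L.Eq.refl , ≤α-of-≈⊤ (L.bot-⇒ L.⊥)) ,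
    λ { (b , αb≤o , c≤αa⇒b) (b′ , αb′≤o , c≤αa′⇒b′) → b L.∨ b′ , α-∨-≤ αb≤o αb′≤o ,
          C.trans (≤α-∧ (C.trans c≤αa⇒b (α-mono _ _ (L.⇒-mono L.refl (L.x≤x∨y b b′))))
                        (C.trans c≤αa′⇒b′ (α-mono _ _ (L.⇒-mono L.refl (L.y≤x∨y b b′)))))
                  (C.reflexive (α-cong (L.Eq.sym (L.∨-⇒ _ _ _)))) }

  consequents-meetClosed : ∀ {c k} → MeetClosed (consequents c k)
  consequents-meetClosed = (L.⊤ , ≤α-of-≈⊤ L.Eq.refl , ≤α-of-≈⊤ (L.⇒-top L.⊤)) ,
    λ { (a , k≤αa , c≤αa⇒b) (a′ , k≤αa′ , c≤αa′⇒b′) → a L.∧ a′ , ≤α-∧ k≤αa k≤αa′ ,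
          C.trans (≤α-∧ (C.trans c≤αa⇒b (α-mono _ _ (L.⇒-mono (L.x∧y≤x a a′) L.refl)))
                        (C.trans c≤αa′⇒b′ (α-mono _ _ (L.⇒-mono (L.x∧y≤y a a′) L.refl))))
                  (C.reflexive (α-cong (L.Eq.sym (L.⇒-∧ _ _ _)))) }

  ≤⇒^π⇔antecedents : ∀ {c u v} → Closed c →
                     c ≤ u ⇒^π v ⇔ (∀ {o} → Open o → v ≤ o → u ≤ ⋁ α[ antecedents c o ])
  ≤⇒^π⇔antecedents c-closed = mk⇔
    (λ c≤u⇒v {o} o-open v≤o → from (≤⋁α⇔ antecedents-joinClosed) λ k-closed k≤u →
       let a , b , k≤αa , αb≤o , c≤αa⇒b = to (≤⇒^π⇔ c-closed) c≤u⇒v k-closed o-open k≤u v≤o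
       in a , (b , αb≤o , c≤αa⇒b) , k≤αa)
    (λ covered → from (≤⇒^π⇔ c-closed) λ {k} {o} k-closed o-open k≤u v≤o →
       let a , (b , αb≤o , c≤αa⇒b) , k≤αa =
             to (≤⋁α⇔ antecedents-joinClosed) (covered o-open v≤o) k-closed k≤u
       in a , b , k≤αa , αb≤o , c≤αa⇒b)

  ≤⇒^π⇔consequents : ∀ {c u v} → Closed c →
                     c ≤ u ⇒^π v ⇔ (∀ {k} → Closed k → k ≤ u → ⋀ α[ consequents c k ] ≤ v)
  ≤⇒^π⇔consequents c-closed = mk⇔
    (λ c≤u⇒v {k} k-closed k≤u → from (⋀α≤⇔ consequents-meetClosed) λ o-open v≤o →
       let a , b , k≤αa , αb≤o , c≤αa⇒b = to (≤⇒^π⇔ c-closed) c≤u⇒v k-closed o-open k≤u v≤o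
       in b , (a , k≤αa , c≤αa⇒b) , αb≤o)
    (λ covered → from (≤⇒^π⇔ c-closed) λ {k} {o} k-closed o-open k≤u v≤o →
       let b , (a , k≤αa , c≤αa⇒b) , αb≤o =
             to (⋀α≤⇔ consequents-meetClosed) (covered k-closed k≤u) o-open v≤o
       in a , b , k≤αa , αb≤o , c≤αa⇒b)

  ⇒^π-∨ : ∀ x y z → (x ∨ y) ⇒^π z ≈ (x ⇒^π z) ∧ (y ⇒^π z)
  ⇒^π-∨ x y z = C.antisym
    (C.∧-greatest (⇒^π-mono (C.x≤x∨y x y) C.refl) (⇒^π-mono (C.y≤x∨y x y) C.refl))
    (≤-from-closed λ c-closed c≤x⇒z∧y⇒z →
      from (≤⇒^π⇔antecedents c-closed) λ o-open z≤o → C.∨-least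
        (to (≤⇒^π⇔antecedents c-closed) (C.trans c≤x⇒z∧y⇒z (C.x∧y≤x _ _)) o-open z≤o)
        (to (≤⇒^π⇔antecedents c-closed) (C.trans c≤x⇒z∧y⇒z (C.x∧y≤y _ _)) o-open z≤o))

  ⇒^π-∧ : ∀ x y z → x ⇒^π (y ∧ z) ≈ (x ⇒^π y) ∧ (x ⇒^π z)
  ⇒^π-∧ x y z = C.antisym
    (C.∧-greatest (⇒^π-mono C.refl (C.x∧y≤x y z)) (⇒^π-mono C.refl (C.x∧y≤y y z)))
    (≤-from-closed λ c-closed c≤x⇒y∧x⇒z →
      from (≤⇒^π⇔consequents c-closed) λ k-closed k≤x → C.∧-greatest
        (to (≤⇒^π⇔consequents c-closed) (C.trans c≤x⇒y∧x⇒z (C.x∧y≤x _ _)) k-closed k≤x)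
        (to (≤⇒^π⇔consequents c-closed) (C.trans c≤x⇒y∧x⇒z (C.x∧y≤y _ _)) k-closed k≤x))

  ⇒^π-bot : ∀ v → bot ⇒^π v ≈ top
  ⇒^π-bot v = C.antisym (C.maximum _) (C.trans (C.≥-reflexive α-⊤)
    (from (≤⇒^π⇔antecedents (closed-≈α C.Eq.refl)) λ _ _ → C.minimum _))

  ⇒^π-top : ∀ u → u ⇒^π top ≈ top
  ⇒^π-top u = C.antisym (C.maximum _) (C.trans (C.≥-reflexive α-⊤)
    (from (≤⇒^π⇔consequents (closed-≈α C.Eq.refl)) λ _ _ → C.maximum _))

  module ◇ = JoinPreserving L.◇-cong L.◇-∨ L.◇-bot
  module □ = MeetPreserving L.□-cong L.□-∧ L.□-top

  x≤□^π◇^σx : (∀ a → a L.≤ L.□ (L.◇ a)) → ∀ x → x ≤ (L.□ ^π) ((L.◇ ^σ) x)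
  x≤□^π◇^σx a≤□◇a x = C.⋀-greatest _ x λ { y (o , o-open , ◇x≤o , y≈) →
    C.trans (C.trans (to (◇.^σ≤⇔≤⋁ o-open) ◇x≤o) (⋁◇⁻¹↓≤⋁□[↓] o)) (C.≥-reflexive y≈) }
    where
    ⋁◇⁻¹↓≤⋁□[↓] : ∀ o → ⋁ α[ ◇.f⁻¹↓ o ] ≤ ⋁ (L.□ [↓ o ])
    ⋁◇⁻¹↓≤⋁□[↓] o = C.⋁-least _ _ λ { z (a , α◇a≤o , z≈αa) →
      C.trans (C.reflexive z≈αa) (C.trans (α-mono _ _ (a≤□◇a a)) (≤⋁[↓] L.□ α◇a≤o)) }

  ◇^σ□^πx≤x : (∀ a → L.◇ (L.□ a) L.≤ a) → ∀ x → (L.◇ ^σ) ((L.□ ^π) x) ≤ x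
  ◇^σ□^πx≤x ◇□a≤a x = C.⋁-least _ x λ { y (k , k-closed , k≤□x , y≈) →
    C.trans (C.reflexive y≈) (C.trans (⋀◇[↑]≤⋀□⁻¹↑ k) (to (□.≤^π⇔⋀≤ k-closed) k≤□x)) }
    where
    ⋀◇[↑]≤⋀□⁻¹↑ : ∀ k → ⋀ (L.◇ [↑ k ]) ≤ ⋀ α[ □.f⁻¹↑ k ]
    ⋀◇[↑]≤⋀□⁻¹↑ k = C.⋀-greatest _ _ λ { z (a , k≤α□a , z≈αa) →
      C.trans (⋀[↑]≤ L.◇ k≤α□a) (C.trans (α-mono _ _ (◇□a≤a a)) (C.≥-reflexive z≈αa)) }

proposition6p5 : ∀ {ℓ : Level} (L : IML ℓ) → InVariety L →
                 (C : CompleteLattice ℓ) (E : CanonicalExtension L C) →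
                 IMLAxioms (CompleteLattice._≈_ C) (CompleteLattice._∧_ C) (CompleteLattice._∨_ C)
                           (CompleteLattice.bot C) (CompleteLattice.top C)
                           (⇒π L C E) (□π L C E) (◇σ L C E)
                 × BoxDiaAxioms (CompleteLattice._≤_ C) (□π L C E) (◇σ L C E)
proposition6p5 L L-in-variety C E =
  record
    { ⇒-cong = ⇒^π-cong
    ; □-cong = ^π-cong (IML.□ L)
    ; ◇-cong = ^σ-cong (IML.◇ L)
    ; ∨-⇒    = ⇒^π-∨
    ; ⇒-∧    = ⇒^π-∧
    ; bot-⇒  = ⇒^π-bot
    ; ⇒-top  = ⇒^π-top
    ; □-∧    = □.^π-∧
    ; □-top  = □.^π-top
    ; ◇-∨    = ◇.^σ-∨
    ; ◇-bot  = ◇.^σ-bot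
    }
  , record
    { unit   = x≤□^π◇^σx (BoxDiaAxioms.unit L-in-variety)
    ; counit = ◇^σ□^πx≤x (BoxDiaAxioms.counit L-in-variety)
    }
  where open CanonicalExtensionProperties L C E
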